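{- Let $K_{7,7,7}$ be the complete tripartite graph with vertex set $\{j_i\mid j\in\mathbb{Z}_7,\ i\in\mathbb{Z}_3\}$ and parts $V_i=\{j_i\mid j\in\mathbb{Z}_7\}$, $i\in\mathbb{Z}_3$. For $i,j\in\mathbb{Z}_3$ and $d\in\mathbb{Z}_7$ let $E_{ij}(d)=\{\{l_i,(l+d)_j\}\mid l\in\mathbb{Z}_7\}$. Then the edge set $\bigcup_{d\in\{3,4\}}\left(E_{01}(d)\cup E_{12}(d)\cup E_{20}(d)\right)$ can be partitioned into the edge sets of two $C_7$-factors of $K_{7,7,7}$.
   Context: A $C_7$-factor of a graph $G$ is a spanning subgraph of $G$ each of whose components is a cycle of length 7. -}

module Defs where

open import Data.Nat using (ℕ; _+_; _%_)
open import Data.Nat.DivMod using (m%n<n)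
open import Data.Fin using (Fin; toℕ; fromℕ<; zero; suc)
open import Data.Product using (Σ; _×_; _,_; proj₁; proj₂; ∃-syntax)
open import Data.Sum using (_⊎_)
open import Relation.Binary.PropositionalEquality using (_≡_; _≢_)
open import Function.Definitions using (Injective; Surjective)

_⊕_ : Fin 7 → Fin 7 → Fin 7
a ⊕ b = fromℕ< (m%n<n (toℕ a + toℕ b) 7)

-- vertex j_i of K_{7,7,7} is the pair (j , i) with j ∈ ℤ_7, i ∈ ℤ_3
V : Set
V = Fin 7 × Fin 3

KAdj : V → V → Set
KAdj u v = proj₂ u ≢ proj₂ v

SamePair : V → V → V → V → Set
SamePair u v a b = (u ≡ a × v ≡ b) ⊎ (u ≡ b × v ≡ a)

InE : Fin 3 → Fin 3 → Fin 7 → V → V → Set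
InE i j d u v = ∃[ l ] SamePair u v (l , i) (l ⊕ d , j)

InD : Fin 7 → Set
InD d = (d ≡ suc (suc (suc zero))) ⊎ (d ≡ suc (suc (suc (suc zero))))

InS : V → V → Set
InS u v = ∃[ d ] (InD d × (InE zero (suc zero) d u v
                           ⊎ InE (suc zero) (suc (suc zero)) d u v
                           ⊎ InE (suc (suc zero)) zero d u v))

next : Fin 7 → Fin 7
next k = k ⊕ suc zero

record Cycle7 : Set where
  field
    vtx   : Fin 7 → V
    inj   : Injective _≡_ _≡_ vtx
    adj   : ∀ k → KAdj (vtx k) (vtx (next k))

-- a C_7-factor of K_{7,7,7}: a family of n cycles of length 7 that are
-- vertex-disjoint and together cover every vertex; its edge set is the union
-- of the edge sets of the cycles (so the components are exactly these cycles)
record C7Factor : Set where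
  field
    n      : ℕ
    cyc    : Fin n → Cycle7
  at : Fin n × Fin 7 → V
  at (m , k) = Cycle7.vtx (cyc m) k
  field
    disjoint : Injective _≡_ _≡_ at
    spanning : Surjective _≡_ _≡_ at
  Edge : V → V → Set
  Edge u v = ∃[ m ] ∃[ k ] SamePair u v (at (m , k)) (at (m , next k))

-- The edges in question form a 4-regular graph on the 21 vertices: for each
-- pair of parts, the differences 3 and 4 give a Hamiltonian 14-cycle on
-- V_i ∪ V_j. Two explicit families of three disjoint 7-cycles split these 42
-- edges; as vertices and edges range over finite sets, every property claimed
-- of them is decidable and is confirmed by evaluation.
module Submission where

open import Defs
open import Data.Product using (_×_; _,_; ∃; ∃-syntax; proj₁; proj₂; uncurry)
open import Data.Product.Properties using (≡-dec)
open import Data.Sum using (_⊎_)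
open import Data.Fin using (Fin; #_)
import Data.Fin as Fin
open import Data.Fin.Properties using (all?; any?)
open import Data.Vec using (Vec; _∷_; []; lookup)
open import Function.Bundles using (_⇔_; mk⇔; Equivalence)
open import Function.Definitions using (Injective; Surjective)
open import Relation.Binary using (DecidableEquality)
open import Relation.Binary.PropositionalEquality using (_≡_; refl)
open import Relation.Nullary using (¬_)
open import Relation.Nullary.Decidable
  using (Dec; True; toWitness; map′; ¬?; _×-dec_; _⊎-dec_; _→-dec_)
open import Relation.Unary using (Pred; Decidable)
open import Level using (0ℓ)

_⇔-dec_ : {A B : Set} → Dec A → Dec B → Dec (A ⇔ B)
a? ⇔-dec b? = map′ (uncurry mk⇔) (λ e → Equivalence.to e , Equivalence.from e)
  ((a? →-dec b?) ×-dec (b? →-dec a?))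

all×? : ∀ {m n} {P : Pred (Fin m × Fin n) 0ℓ} → Decidable P → Dec (∀ x → P x)
all×? P? = map′ (λ h x → h (proj₁ x) (proj₂ x)) (λ h i j → h (i , j))
  (all? λ i → all? λ j → P? (i , j))

any×? : ∀ {m n} {P : Pred (Fin m × Fin n) 0ℓ} → Decidable P → Dec (∃ P)
any×? P? = map′ (λ { (i , j , p) → (i , j) , p }) (λ { ((i , j) , p) → i , j , p })
  (any? λ i → any? λ j → P? (i , j))

AllDec : Set → Set₁
AllDec A = ∀ {P : Pred A 0ℓ} → Decidable P → Dec (∀ x → P x)

AnyDec : Set → Set₁
AnyDec A = ∀ {P : Pred A 0ℓ} → Decidable P → Dec (∃ P)

injective? : {A B : Set} → AllDec A → DecidableEquality A → DecidableEquality B →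
             (f : A → B) → Dec (Injective _≡_ _≡_ f)
injective? all _≟A_ _≟B_ f = map′ (λ h {x} {y} → h x y) (λ h x y → h)
  (all λ x → all λ y → (f x ≟B f y) →-dec (x ≟A y))

surjective? : {A B : Set} → AnyDec A → AllDec B → DecidableEquality B →
              (f : A → B) → Dec (Surjective _≡_ _≡_ f)
surjective? any all _≟B_ f =
  map′ (λ h y → proj₁ (h y) , λ { refl → proj₂ (h y) })
       (λ h y → proj₁ (h y) , proj₂ (h y) refl)
       (all λ y → any λ x → f x ≟B y)

_≟V_ : DecidableEquality V
_≟V_ = ≡-dec Fin._≟_ Fin._≟_

samePair? : ∀ u v a b → Dec (SamePair u v a b)
samePair? u v a b = ((u ≟V a) ×-dec (v ≟V b)) ⊎-dec ((u ≟V b) ×-dec (v ≟V a))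

inE? : ∀ i j d u v → Dec (InE i j d u v)
inE? i j d u v = any? λ l → samePair? u v (l , i) (l ⊕ d , j)

inD? : ∀ d → Dec (InD d)
inD? d = (d Fin.≟ _) ⊎-dec (d Fin.≟ _)

inS? : ∀ u v → Dec (InS u v)
inS? u v = any? λ d → inD? d ×-dec
  (inE? _ _ d u v ⊎-dec inE? _ _ d u v ⊎-dec inE? _ _ d u v)

IsCycle7 : (Fin 7 → V) → Set
IsCycle7 c = Injective _≡_ _≡_ c × (∀ k → KAdj (c k) (c (next k)))

isCycle7? : ∀ c → Dec (IsCycle7 c)
isCycle7? c = injective? all? Fin._≟_ _≟V_ c
  ×-dec (all? λ k → ¬? (proj₂ (c k) Fin.≟ proj₂ (c (next k))))

toCycle7 : (c : Fin 7 → V) → IsCycle7 c → Cycle7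
toCycle7 c (inj , adj) = record { vtx = c ; inj = inj ; adj = adj }

IsC7Factor : ∀ {n} → (Fin n → Fin 7 → V) → Set
IsC7Factor cs = (∀ m → IsCycle7 (cs m))
  × Injective _≡_ _≡_ (uncurry cs) × Surjective _≡_ _≡_ (uncurry cs)

isC7Factor? : ∀ {n} (cs : Fin n → Fin 7 → V) → Dec (IsC7Factor cs)
isC7Factor? cs = (all? λ m → isCycle7? (cs m))
  ×-dec injective? all×? (≡-dec Fin._≟_ Fin._≟_) _≟V_ (uncurry cs)
  ×-dec surjective? any×? all×? _≟V_ (uncurry cs)

toC7Factor : ∀ {n} (cs : Fin n → Fin 7 → V) → IsC7Factor cs → C7Factor
toC7Factor {n} cs (cyc , disjoint , spanning) = record
  { n = n
  ; cyc = λ m → toCycle7 (cs m) (cyc m)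
  ; disjoint = disjoint
  ; spanning = spanning
  }

edge? : ∀ F u v → Dec (C7Factor.Edge F u v)
edge? F u v = any? λ m → any? λ k →
  samePair? u v (C7Factor.at F (m , k)) (C7Factor.at F (m , next k))

PartitionedBy : C7Factor → C7Factor → V → V → Set
PartitionedBy F₁ F₂ u v = (InS u v ⇔ (C7Factor.Edge F₁ u v ⊎ C7Factor.Edge F₂ u v))
                        × ¬ (C7Factor.Edge F₁ u v × C7Factor.Edge F₂ u v)

partitionedBy? : ∀ F₁ F₂ u v → Dec (PartitionedBy F₁ F₂ u v)
partitionedBy? F₁ F₂ u v = (inS? u v ⇔-dec (edge? F₁ u v ⊎-dec edge? F₂ u v))
  ×-dec ¬? (edge? F₁ u v ×-dec edge? F₂ u v)

cycles₁ : Vec (Vec V 7) 3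
cycles₁ =
  ((# 3 , # 1) ∷ (# 0 , # 0) ∷ (# 4 , # 1) ∷ (# 1 , # 0) ∷ (# 5 , # 1) ∷ (# 2 , # 0) ∷ (# 6 , # 2) ∷ []) ∷
  ((# 0 , # 1) ∷ (# 3 , # 2) ∷ (# 6 , # 0) ∷ (# 2 , # 1) ∷ (# 5 , # 2) ∷ (# 1 , # 1) ∷ (# 4 , # 2) ∷ []) ∷
  ((# 0 , # 2) ∷ (# 3 , # 0) ∷ (# 6 , # 1) ∷ (# 2 , # 2) ∷ (# 5 , # 0) ∷ (# 1 , # 2) ∷ (# 4 , # 0) ∷ []) ∷ []

cycles₂ : Vec (Vec V 7) 3
cycles₂ =
  ((# 3 , # 2) ∷ (# 0 , # 0) ∷ (# 4 , # 2) ∷ (# 1 , # 0) ∷ (# 5 , # 2) ∷ (# 2 , # 0) ∷ (# 6 , # 1) ∷ []) ∷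
  ((# 0 , # 1) ∷ (# 3 , # 0) ∷ (# 6 , # 2) ∷ (# 2 , # 1) ∷ (# 5 , # 0) ∷ (# 1 , # 1) ∷ (# 4 , # 0) ∷ []) ∷
  ((# 3 , # 1) ∷ (# 0 , # 2) ∷ (# 4 , # 1) ∷ (# 1 , # 2) ∷ (# 5 , # 1) ∷ (# 2 , # 2) ∷ (# 6 , # 0) ∷ []) ∷ []

fromTable : ∀ {n} → Vec (Vec V 7) n → Fin n → Fin 7 → V
fromTable cycles m = lookup (lookup cycles m)

factorOf : ∀ {n} (cycles : Vec (Vec V 7) n) →
           {True (isC7Factor? (fromTable cycles))} → C7Factor
factorOf cycles {isFactor} =
  toC7Factor (fromTable cycles) (toWitness isFactor)

lemma2p5 : ∃[ F₁ ] ∃[ F₂ ]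
    (∀ u v → (InS u v ⇔ (C7Factor.Edge F₁ u v ⊎ C7Factor.Edge F₂ u v))
           × ¬ (C7Factor.Edge F₁ u v × C7Factor.Edge F₂ u v))
lemma2p5 = F₁ , F₂ , toWitness {a? = all×? λ u → all×? λ v → partitionedBy? F₁ F₂ u v} _
  where
    F₁ F₂ : C7Factor
    F₁ = factorOf cycles₁
    F₂ = factorOf cycles₂
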